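{- For every integer $n \geq 3$ and every integer $m \geq 0$, $C_n^{(2)} \oplus I_m \in GR(3)$.
   Context: A $k$-colored graph $G=(V,E)$ consists of a finite set $V$ and a function $E$ from the 2-element subsets of $V$ to $\{0,\ldots,k-1\}$. An automorphism of $G$ is a permutation of $V$ preserving $E$; $Aut(G)$ is the automorphism group as a permutation group on $V$. Permutation groups are considered up to permutation isomorphism. $GR(k)$ is the class of permutation groups $(A,V)$ with $A=Aut(G)$ for some $k$-colored graph $G$ on $V$. $C_n$ denotes the regular action of $\mathbb{Z}_n$ on $n$ points. $I_m$ denotes the trivial (identity-only) group acting on $m$ points; $A\oplus I_0=A$. For $(A,V)$, the parallel product $A^{(r)}$ is $A$ acting on $V\times\{1,\ldots,r\}$ by $a((v,i))=(a(v),i)$. For permutation groups $(A,V)$, $(B,W)$ with disjoint domains, the direct sum $A\oplus B$ is the group of pairs $(a,b)$ acting on $V\cup W$, with $a$ acting on $V$ and $b$ on $W$. -}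

module Defs where

open import Data.Nat using (ℕ; zero; suc; _+_)
open import Data.Nat.DivMod using (_mod_)
open import Data.Fin using (Fin; toℕ)
open import Data.Product using (Σ; _×_; _,_; ∃-syntax)
open import Data.Sum using (_⊎_; inj₁; inj₂)
open import Relation.Binary.PropositionalEquality using (_≡_; _≢_)
open import Function.Bundles using (_↔_; Inverse)

-- A k-colored graph on vertex set V: a colouring of the 2-element subsets
-- {x , y} (x ≢ y) by Fin k.  Represented as a symmetric function on
-- ordered pairs of distinct vertices.
record ColoredGraph (k : ℕ) (V : Set) : Set where
  field
    col  : (x y : V) → x ≢ y → Fin k
    symm : (x y : V) (p : x ≢ y) (q : y ≢ x) → col x y p ≡ col y x q

open ColoredGraph public

IsAut : ∀ {k V} → ColoredGraph k V → V ↔ V → Set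
IsAut {V = V} G π =
  (x y : V) (p : x ≢ y) (q : Inverse.to π x ≢ Inverse.to π y) →
  col G (Inverse.to π x) (Inverse.to π y) q ≡ col G x y p

addMod : ∀ {n} → Fin n → Fin n → Fin n
addMod {suc n} i j = (toℕ i + toℕ j) mod (suc n)

-- Domain of C_n^(2) ⊕ I_m : (Fin n × Fin 2) ⊎ Fin m.
Dom : ℕ → ℕ → Set
Dom n m = (Fin n × Fin 2) ⊎ Fin m

act : ∀ {n m} → Fin n → Dom n m → Dom n m
act k (inj₁ (i , j)) = inj₁ (addMod i k , j)
act k (inj₂ u)       = inj₂ u

InCn2⊕Im : ∀ {n m} → (Dom n m → Dom n m) → Set
InCn2⊕Im {n} {m} f = ∃[ k ] ((v : Dom n m) → f v ≡ act {n} {m} k v)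

-- C_n^(2) ⊕ I_m ∈ GR(k): there is a k-colored graph G on a finite set
-- (w.l.o.g. Fin N) and a bijection φ : Dom n m ↔ Fin N such that
-- φ⁻¹ Aut(G) φ = C_n^(2) ⊕ I_m (permutation isomorphism).
Cn2⊕Im∈GR : ℕ → ℕ → ℕ → Set
Cn2⊕Im∈GR k n m =
  Σ ℕ λ N → Σ (ColoredGraph k (Fin N)) λ G → Σ (Dom n m ↔ Fin N) λ φ →
    ((π : Fin N ↔ Fin N) →
      (IsAut G π →
         InCn2⊕Im {n} {m} (λ v → Inverse.from φ (Inverse.to π (Inverse.to φ v))))
    × (InCn2⊕Im {n} {m} (λ v → Inverse.from φ (Inverse.to π (Inverse.to φ v))) →
         IsAut G π))

module Submission where

-- Write the domain as A₀…A_{n-1} ∪ B₀…B_{n-1} ∪ U₀…U_{m-1}, indices of A and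
-- B read in ℤ_n.  Colour the pairs (white = 0, red = 1, blue = 2):
--   the A's form a red clique and the B's a white one;  A_i B_i is blue and
--   A_{i+1} B_i is red;  U₀ is blue to every A;  U_s U_{s+1} is blue;
--   every other pair is white.
-- The rotations i ↦ i + k of ℤ_n (acting on A and B, fixing U) preserve
-- these colours.  Conversely, let ψ preserve them.  A vertex with two red
-- neighbours is an A, so ψ(A₀), ψ(A₁) are A's; the only vertex blue to two
-- A's is U₀, so ψ fixes U₀, and then the blue path U₀U₁… pointwise.  The
-- blue edge A_i B_i and the red edge B_i A_{i+1} then force
-- ψ(A_{i+1}) = A_{j+1} whenever ψ(A_i) = A_j, so ψ is the rotation by k
-- where ψ(A₀) = A_k.

open import Defs
open import Data.Nat as ℕ using (ℕ; zero; suc; _+_; _*_; _∸_; _≤_; _<_; z≤n; s≤s; _%_)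
import Data.Nat.Properties as ℕP
open import Data.Nat.DivMod
  using (_mod_; %-distribˡ-+; m%n%n≡m%n; m<n⇒m%n≡m; n%n≡0)
open import Data.Fin as F using (Fin; zero; suc; toℕ; inject₁)
open import Data.Fin.Properties
  using (toℕ-injective; toℕ-fromℕ<; toℕ<n; toℕ-inject₁; +↔⊎; *↔×)
open import Data.Product using (∃; _×_; _,_; proj₁; proj₂)
open import Data.Sum using (_⊎_; inj₁; inj₂)
import Data.Sum as Sum
open import Data.Empty using (⊥-elim)
open import Relation.Nullary using (Dec; yes; no; ¬_)
open import Relation.Nullary.Decidable using (_⊎-dec_)
open import Relation.Binary.PropositionalEquality
  using (_≡_; _≢_; refl; sym; trans; cong; cong₂; subst; module ≡-Reasoning)
open import Function using (_∘_)
open import Function.Bundles using (_↔_; Inverse; Injection)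
open import Function.Properties.Inverse using (↔-trans; ↔-sym; ↔-refl; ↔⇒↣)
open import Data.Sum.Function.Propositional using (_⊎-↔_)

module Cyclic (n′ : ℕ) where

  n : ℕ
  n = suc n′

  toℕ-mod : (t : ℕ) → toℕ (t mod n) ≡ t % n
  toℕ-mod t = toℕ-fromℕ< _

  toℕ-addMod : (i j : Fin n) → toℕ (addMod i j) ≡ (toℕ i + toℕ j) % n
  toℕ-addMod i j = toℕ-mod (toℕ i + toℕ j)

  %-absorbˡ : ∀ x y → (x % n + y) % n ≡ (x + y) % n
  %-absorbˡ x y = begin
    (x % n + y) % n          ≡⟨ %-distribˡ-+ (x % n) y n ⟩
    (x % n % n + y % n) % n  ≡⟨ cong (λ z → (z + y % n) % n) (m%n%n≡m%n x n) ⟩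
    (x % n + y % n) % n      ≡⟨ %-distribˡ-+ x y n ⟨
    (x + y) % n              ∎
    where open ≡-Reasoning

  %-absorbʳ : ∀ x y → (x + y % n) % n ≡ (x + y) % n
  %-absorbʳ x y = begin
    (x + y % n) % n  ≡⟨ cong (_% n) (ℕP.+-comm x (y % n)) ⟩
    (y % n + x) % n  ≡⟨ %-absorbˡ y x ⟩
    (y + x) % n      ≡⟨ cong (_% n) (ℕP.+-comm y x) ⟩
    (x + y) % n      ∎
    where open ≡-Reasoning

  mod-toℕ : (i : Fin n) → toℕ i mod n ≡ i
  mod-toℕ i = toℕ-injective (trans (toℕ-mod (toℕ i)) (m<n⇒m%n≡m (toℕ<n i)))

  addMod-comm : (i j : Fin n) → addMod i j ≡ addMod j i
  addMod-comm i j = cong (_mod n) (ℕP.+-comm (toℕ i) (toℕ j))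

  addMod-assoc : (i j k : Fin n) → addMod (addMod i j) k ≡ addMod i (addMod j k)
  addMod-assoc i j k = toℕ-injective (begin
    toℕ (addMod (addMod i j) k)          ≡⟨ toℕ-addMod (addMod i j) k ⟩
    (toℕ (addMod i j) + K) % n           ≡⟨ cong (λ z → (z + K) % n) (toℕ-addMod i j) ⟩
    ((I + J) % n + K) % n                ≡⟨ %-absorbˡ (I + J) K ⟩
    (I + J + K) % n                      ≡⟨ cong (_% n) (ℕP.+-assoc I J K) ⟩
    (I + (J + K)) % n                    ≡⟨ %-absorbʳ I (J + K) ⟨
    (I + (J + K) % n) % n                ≡⟨ cong (λ z → (I + z) % n) (toℕ-addMod j k) ⟨
    (I + toℕ (addMod j k)) % n           ≡⟨ toℕ-addMod i (addMod j k) ⟨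
    toℕ (addMod i (addMod j k))          ∎)
    where
      open ≡-Reasoning
      I = toℕ i
      J = toℕ j
      K = toℕ k

  addMod-identityʳ : (i : Fin n) → addMod i zero ≡ i
  addMod-identityʳ i = trans (cong (_mod n) (ℕP.+-identityʳ (toℕ i))) (mod-toℕ i)

  addMod-identityˡ : (i : Fin n) → addMod zero i ≡ i
  addMod-identityˡ i = trans (addMod-comm zero i) (addMod-identityʳ i)

  negMod : Fin n → Fin n
  negMod k = (n ∸ toℕ k) mod n

  addMod-inverseʳ : (k : Fin n) → addMod k (negMod k) ≡ zero
  addMod-inverseʳ k = toℕ-injective (begin
    toℕ (addMod k (negMod k))   ≡⟨ toℕ-addMod k (negMod k) ⟩
    (K + toℕ (negMod k)) % n    ≡⟨ cong (λ z → (K + z) % n) (toℕ-mod (n ∸ K)) ⟩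
    (K + (n ∸ K) % n) % n       ≡⟨ %-absorbʳ K (n ∸ K) ⟩
    (K + (n ∸ K)) % n           ≡⟨ cong (_% n) (ℕP.m+[n∸m]≡n (ℕP.<⇒≤ (toℕ<n k))) ⟩
    n % n                       ≡⟨ n%n≡0 n ⟩
    0                           ∎)
    where
      open ≡-Reasoning
      K = toℕ k

  addMod-cancelʳ : {i j k : Fin n} → addMod i k ≡ addMod j k → i ≡ j
  addMod-cancelʳ {i} {j} {k} e = trans (sym (undo i)) (trans (cong (λ z → addMod z (negMod k)) e) (undo j))
    where
      undo : ∀ x → addMod (addMod x k) (negMod k) ≡ x
      undo x = trans (addMod-assoc x k (negMod k))
                     (trans (cong (addMod x) (addMod-inverseʳ k)) (addMod-identityʳ x))

  one : Fin n
  one = 1 mod n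

  sucMod : Fin n → Fin n
  sucMod i = addMod i one

  sucMod-addMod : (i k : Fin n) → addMod (sucMod i) k ≡ sucMod (addMod i k)
  sucMod-addMod i k = begin
    addMod (addMod i one) k   ≡⟨ addMod-assoc i one k ⟩
    addMod i (addMod one k)   ≡⟨ cong (addMod i) (addMod-comm one k) ⟩
    addMod i (addMod k one)   ≡⟨ addMod-assoc i k one ⟨
    addMod (addMod i k) one   ∎
    where open ≡-Reasoning

  mod-suc : ∀ t → suc t mod n ≡ sucMod (t mod n)
  mod-suc t = toℕ-injective (begin
    toℕ (suc t mod n)                    ≡⟨ toℕ-mod (suc t) ⟩
    suc t % n                            ≡⟨ cong (_% n) (ℕP.+-comm 1 t) ⟩
    (t + 1) % n                          ≡⟨ %-distribˡ-+ t 1 n ⟩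
    (t % n + 1 % n) % n                  ≡⟨ cong₂ (λ a b → (a + b) % n) (toℕ-mod t) (toℕ-mod 1) ⟨
    (toℕ (t mod n) + toℕ one) % n        ≡⟨ toℕ-addMod (t mod n) one ⟨
    toℕ (sucMod (t mod n))               ∎)
    where open ≡-Reasoning

  sucMod-fixedPointFree : 1 < n → (i : Fin n) → sucMod i ≢ i
  sucMod-fixedPointFree 1<n i e = 1≢0 (cong toℕ (addMod-cancelʳ onei≡zeroi))
    where
      onei≡zeroi : addMod one i ≡ addMod zero i
      onei≡zeroi = trans (addMod-comm one i) (trans e (sym (addMod-identityˡ i)))
      1≢0 : toℕ one ≢ 0
      1≢0 e′ with () ← trans (sym (m<n⇒m%n≡m 1<n)) (trans (sym (toℕ-mod 1)) e′)

  orbit-induction : (R : Fin n → Fin n → Set) (k : Fin n) → R zero k →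
                    (∀ {i j} → R i j → R (sucMod i) (sucMod j)) →
                    ∀ i → R i (addMod i k)
  orbit-induction R k base step i = subst (λ x → R x (addMod x k)) (mod-toℕ i) (along (toℕ i))
    where
      along : ∀ t → R (t mod n) (addMod (t mod n) k)
      along zero = subst (R zero) (sym (addMod-identityˡ k)) base
      along (suc t) rewrite mod-suc t | sucMod-addMod (t mod n) k = step (along t)

predecessor : ∀ {m} (t : Fin m) {s} → toℕ t ≡ suc s → ∃ λ (p : Fin m) → toℕ p ≡ s
predecessor zero ()
predecessor (suc t₀) eq = inject₁ t₀ , trans (toℕ-inject₁ t₀) (ℕP.suc-injective eq)

white red blue : Fin 3
white = zero
red   = suc zero
blue  = suc (suc zero)

choose : {P C : Set} → Dec P → C → C → C
choose (yes _) a _ = a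
choose (no _)  _ b = b

module _ {C : Set} {a b : C} {P : Set} where

  choose-yes : P → (p : Dec P) → choose p a b ≡ a
  choose-yes _  (yes _) = refl
  choose-yes x  (no ¬x) = ⊥-elim (¬x x)

  choose-no : ¬ P → (p : Dec P) → choose p a b ≡ b
  choose-no ¬x (yes x) = ⊥-elim (¬x x)
  choose-no _  (no _)  = refl

  choose-cong : {Q : Set} → (P → Q) → (Q → P) → (p : Dec P) (q : Dec Q) →
                choose p a b ≡ choose q a b
  choose-cong f g (yes x) (yes _) = refl
  choose-cong f g (yes x) (no ¬y) = ⊥-elim (¬y (f x))
  choose-cong f g (no ¬x) (yes y) = ⊥-elim (¬x (g y))
  choose-cong f g (no ¬x) (no _)  = refl

  choose-holds : {c : C} → b ≢ c → (p : Dec P) → choose p a b ≡ c → P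
  choose-holds _   (yes x) _ = x
  choose-holds b≢c (no _)  e = ⊥-elim (b≢c e)

  choose-fallback : {c : C} → a ≢ c → (p : Dec P) → choose p a b ≡ c → b ≡ c
  choose-fallback a≢c (yes _) e = ⊥-elim (a≢c e)
  choose-fallback _   (no _)  e = e

  choose-avoids : {c : C} → a ≢ c → b ≢ c → (p : Dec P) → choose p a b ≢ c
  choose-avoids a≢c b≢c p e = b≢c (choose-fallback a≢c p e)

pattern A i = inj₁ (i , zero)
pattern B i = inj₁ (i , suc zero)
pattern U t = inj₂ t

module Colouring (n₀ m : ℕ) where

  open Cyclic (suc (suc n₀)) public

  D : Set
  D = Dom n m

  1<n : 1 < n
  1<n = s≤s (s≤s z≤n)

  colAB : Fin n → Fin n → Fin 3
  colAB i j = choose (i F.≟ j) blue (choose (i F.≟ sucMod j) red white)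

  hook : Fin m → Fin 3
  hook t = choose (toℕ t ℕ.≟ 0) blue white

  Adjacent : Fin m → Fin m → Set
  Adjacent s t = toℕ t ≡ suc (toℕ s) ⊎ toℕ s ≡ suc (toℕ t)

  adjacent? : (s t : Fin m) → Dec (Adjacent s t)
  adjacent? s t = (toℕ t ℕ.≟ suc (toℕ s)) ⊎-dec (toℕ s ℕ.≟ suc (toℕ t))

  colUU : Fin m → Fin m → Fin 3
  colUU s t = choose (adjacent? s t) blue white

  colour : D → D → Fin 3
  colour (A i) (A j) = red
  colour (A i) (B j) = colAB i j
  colour (B i) (A j) = colAB j i
  colour (B i) (B j) = white
  colour (A i) (U t) = hook t
  colour (U t) (A i) = hook t
  colour (B i) (U t) = white
  colour (U t) (B i) = white
  colour (U s) (U t) = colUU s t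

  colour-sym : ∀ x y → colour x y ≡ colour y x
  colour-sym (A i) (A j) = refl
  colour-sym (A i) (B j) = refl
  colour-sym (B i) (A j) = refl
  colour-sym (B i) (B j) = refl
  colour-sym (A i) (U t) = refl
  colour-sym (U t) (A i) = refl
  colour-sym (B i) (U t) = refl
  colour-sym (U t) (B i) = refl
  colour-sym (U s) (U t) = choose-cong Sum.swap Sum.swap (adjacent? s t) (adjacent? t s)

  colAB-rotate : ∀ i j k → colAB (addMod i k) (addMod j k) ≡ colAB i j
  colAB-rotate i j k =
    trans (choose-cong addMod-cancelʳ (cong ρ) (ρ i F.≟ ρ j) (i F.≟ j))
          (cong (choose (i F.≟ j) blue)
                (choose-cong to-succ from-succ (ρ i F.≟ sucMod (ρ j)) (i F.≟ sucMod j)))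
    where
      ρ : Fin n → Fin n
      ρ x = addMod x k
      to-succ : ρ i ≡ sucMod (ρ j) → i ≡ sucMod j
      to-succ e = addMod-cancelʳ (trans e (sym (sucMod-addMod j k)))
      from-succ : i ≡ sucMod j → ρ i ≡ sucMod (ρ j)
      from-succ e = trans (cong ρ e) (sucMod-addMod j k)

  act-preserves : ∀ k x y → colour (act k x) (act k y) ≡ colour x y
  act-preserves k (A i) (A j) = refl
  act-preserves k (A i) (B j) = colAB-rotate i j k
  act-preserves k (B i) (A j) = colAB-rotate j i k
  act-preserves k (B i) (B j) = refl
  act-preserves k (A i) (U t) = refl
  act-preserves k (U t) (A i) = refl
  act-preserves k (B i) (U t) = refl
  act-preserves k (U t) (B i) = refl
  act-preserves k (U s) (U t) = refl

  colAB-diagonal : ∀ i → colAB i i ≡ blue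
  colAB-diagonal i = choose-yes refl (i F.≟ i)

  colAB-successor : ∀ i → colAB (sucMod i) i ≡ red
  colAB-successor i = trans (choose-no (sucMod-fixedPointFree 1<n i) (sucMod i F.≟ i))
                            (choose-yes refl (sucMod i F.≟ sucMod i))

  colAB-blue : ∀ i j → colAB i j ≡ blue → i ≡ j
  colAB-blue i j = choose-holds (choose-avoids (λ ()) (λ ()) (i F.≟ sucMod j)) (i F.≟ j)

  colAB-red : ∀ i j → colAB i j ≡ red → i ≡ sucMod j
  colAB-red i j e = choose-holds (λ ()) (i F.≟ sucMod j) (choose-fallback (λ ()) (i F.≟ j) e)

  hook-blue : ∀ t → toℕ t ≡ 0 → hook t ≡ blue
  hook-blue t z = choose-yes z (toℕ t ℕ.≟ 0)

  hook-white : ∀ t → toℕ t ≢ 0 → hook t ≡ white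
  hook-white t nz = choose-no nz (toℕ t ℕ.≟ 0)

  Hub : D → Set
  Hub y = ∃ λ t → y ≡ U t × toℕ t ≡ 0

  red-of-B : ∀ j y → colour (B j) y ≡ red → y ≡ A (sucMod j)
  red-of-B j (A l) e = cong A (colAB-red l j e)
  red-of-B j (B l) ()
  red-of-B j (U t) ()

  red-centre : ∀ x y z → y ≢ z → colour x y ≡ red → colour x z ≡ red → ∃ λ i → x ≡ A i
  red-centre (A i) y z _ _ _ = i , refl
  red-centre (B j) y z y≢z ey ez = ⊥-elim (y≢z (trans (red-of-B j y ey) (sym (red-of-B j z ez))))
  red-centre (U t) (A i) z _ e _ = ⊥-elim (choose-avoids (λ ()) (λ ()) (toℕ t ℕ.≟ 0) e)
  red-centre (U t) (B i) z _ () _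
  red-centre (U s) (U t) z _ e _ = ⊥-elim (choose-avoids (λ ()) (λ ()) (adjacent? s t) e)

  blue-to-two-A : ∀ y i i′ → i ≢ i′ → colour y (A i) ≡ blue → colour y (A i′) ≡ blue → Hub y
  blue-to-two-A (A l) i i′ _ () _
  blue-to-two-A (B j) i i′ i≢i′ e e′ = ⊥-elim (i≢i′ (trans (colAB-blue i j e) (sym (colAB-blue i′ j e′))))
  blue-to-two-A (U t) i i′ _ e _ = t , refl , choose-holds (λ ()) (toℕ t ℕ.≟ 0) e

  blue-of-A : ∀ i y → colour (A i) y ≡ blue → y ≡ B i ⊎ Hub y
  blue-of-A i (A l) ()
  blue-of-A i (B j) e = inj₁ (cong B (sym (colAB-blue i j e)))
  blue-of-A i (U t) e = inj₂ (t , refl , choose-holds (λ ()) (toℕ t ℕ.≟ 0) e)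

  blue-of-U : ∀ s y → colour (U s) y ≡ blue → (∃ λ i → y ≡ A i) ⊎ (∃ λ t → y ≡ U t × Adjacent s t)
  blue-of-U s (A i) _ = inj₁ (i , refl)
  blue-of-U s (B i) ()
  blue-of-U s (U t) e = inj₂ (t , refl , choose-holds (λ ()) (adjacent? s t) e)

module Rigidity (n₀ m : ℕ) (ψ : Dom (3 + n₀) m → Dom (3 + n₀) m)
                (ψ-injective : ∀ {x y} → ψ x ≡ ψ y → x ≡ y)
                (ψ-preserves : ∀ x y → x ≢ y → Colouring.colour n₀ m (ψ x) (ψ y) ≡ Colouring.colour n₀ m x y) where

  open Colouring n₀ m

  A-injective : ∀ {i j} → _≡_ {A = D} (A i) (A j) → i ≡ j
  A-injective refl = refl

  U-injective : ∀ {r t} → _≡_ {A = D} (U r) (U t) → r ≡ t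
  U-injective refl = refl

  -- A_i with two further A's (there are n ≥ 3 of them) is sent to an A.
  maps-into-A : ∀ i j l → j ≢ l → i ≢ j → i ≢ l → ∃ λ k → ψ (A i) ≡ A k
  maps-into-A i j l j≢l i≢j i≢l =
    red-centre (ψ (A i)) (ψ (A j)) (ψ (A l)) (j≢l ∘ A-injective ∘ ψ-injective)
               (ψ-preserves (A i) (A j) (i≢j ∘ A-injective))
               (ψ-preserves (A i) (A l) (i≢l ∘ A-injective))

  -- ψ(A₀) = A_{k₀} and ψ(A₁) = A_{k₁}; k₀ is the rotation ψ turns out to be.
  image₀ : ∃ λ k → ψ (A zero) ≡ A k
  image₀ = maps-into-A zero (suc zero) (suc (suc zero)) (λ ()) (λ ()) (λ ())

  image₁ : ∃ λ k → ψ (A (suc zero)) ≡ A k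
  image₁ = maps-into-A (suc zero) zero (suc (suc zero)) (λ ()) (λ ()) (λ ())

  k₀ k₁ : Fin n
  k₀ = proj₁ image₀
  k₁ = proj₁ image₁

  ψA₀ : ψ (A zero) ≡ A k₀
  ψA₀ = proj₂ image₀

  ψA₁ : ψ (A (suc zero)) ≡ A k₁
  ψA₁ = proj₂ image₁

  -- ψ(U₀) is blue to the two distinct A's ψ(A₀), ψ(A₁), so it is U₀.
  hub-fixed : ∀ t → toℕ t ≡ 0 → ψ (U t) ≡ U t
  hub-fixed t z with blue-to-two-A (ψ (U t)) k₀ k₁ k₀≢k₁ (blue-to ψA₀) (blue-to ψA₁)
    where
      k₀≢k₁ : k₀ ≢ k₁
      k₀≢k₁ e with () ← ψ-injective (trans ψA₀ (trans (cong A e) (sym ψA₁)))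
      blue-to : ∀ {i k} → ψ (A i) ≡ A k → colour (ψ (U t)) (A k) ≡ blue
      blue-to {i} e = trans (cong (colour (ψ (U t))) (sym e))
                            (trans (ψ-preserves (U t) (A i) (λ ())) (hook-blue t z))
  ... | t′ , e , z′ = trans e (cong U (toℕ-injective (trans z′ (sym z))))

  next-fixed : ∀ p t → toℕ t ≡ suc (toℕ p) → (∀ r → toℕ r ≤ toℕ p → ψ (U r) ≡ U r) →
               ψ (U t) ≡ U t
  next-fixed p t t-next fixed-below = candidates (blue-of-U p (ψ (U t)) blue-p)
    where
      p≢t : U p ≢ U t
      p≢t e = ℕP.1+n≢n (trans (sym t-next) (cong toℕ (sym (U-injective e))))

      blue-p : colour (U p) (ψ (U t)) ≡ blue
      blue-p = trans (cong (λ z → colour z (ψ (U t))) (sym (fixed-below p ℕP.≤-refl)))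
                     (trans (ψ-preserves (U p) (U t) p≢t) (choose-yes (inj₁ t-next) (adjacent? p t)))

      -- U_t is not the hub, so it is white to A₀, whereas the A's are red to A₀.
      white-to-A₀ : colour (ψ (U t)) (ψ (A zero)) ≡ white
      white-to-A₀ = trans (ψ-preserves (U t) (A zero) (λ ()))
                          (hook-white t (λ z → ℕP.0≢1+n (trans (sym z) t-next)))

      -- ψ(U_t) is a blue neighbour of U_p: an A, U_t itself, or the fixed U_{p-1}.
      candidates : (∃ λ i → ψ (U t) ≡ A i) ⊎ (∃ λ r → ψ (U t) ≡ U r × Adjacent p r) →
                   ψ (U t) ≡ U t
      candidates (inj₁ (i , e)) with () ← trans (sym (cong₂ colour e ψA₀)) white-to-A₀
      candidates (inj₂ (r , e , inj₁ r-next)) =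
        trans e (cong U (toℕ-injective (trans r-next (sym t-next))))
      candidates (inj₂ (r , e , inj₂ p-next)) = ⊥-elim (ℕP.1+n≰n (subst (_≤ toℕ p) r≡t r≤p))
        where
          r≤p : toℕ r ≤ toℕ p
          r≤p = subst (toℕ r ≤_) (sym p-next) (ℕP.n≤1+n (toℕ r))
          r≡t : toℕ r ≡ suc (toℕ p)
          r≡t = trans (cong toℕ (U-injective (ψ-injective (trans (fixed-below r r≤p) (sym e))))) t-next

  fixed-upto : ∀ s t → toℕ t ≤ s → ψ (U t) ≡ U t
  fixed-upto zero t le = hub-fixed t (ℕP.n≤0⇒n≡0 le)
  fixed-upto (suc s) t le with ℕP.m≤n⇒m<n∨m≡n le
  ... | inj₁ lt = fixed-upto s t (ℕP.≤-pred lt)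
  ... | inj₂ eq with predecessor t eq
  ...   | p , p≡s = next-fixed p t (trans eq (cong suc (sym p≡s)))
                      (λ r r≤p → fixed-upto s r (subst (toℕ r ≤_) p≡s r≤p))

  -- B_i is the blue neighbour of A_i other than the fixed hub.
  B-follows : ∀ {i j} → ψ (A i) ≡ A j → ψ (B i) ≡ B j
  B-follows {i} {j} e with blue-of-A j (ψ (B i)) blue-j
    where
      blue-j : colour (A j) (ψ (B i)) ≡ blue
      blue-j = trans (cong (λ z → colour z (ψ (B i))) (sym e))
                     (trans (ψ-preserves (A i) (B i) (λ ())) (colAB-diagonal i))
  ... | inj₁ e′ = e′
  ... | inj₂ (t , e′ , z) with () ← ψ-injective (trans e′ (sym (hub-fixed t z)))

  -- A_{i+1} is the red neighbour of B_i.
  A-follows : ∀ {i j} → ψ (B i) ≡ B j → ψ (A (sucMod i)) ≡ A (sucMod j)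
  A-follows {i} {j} e = red-of-B j (ψ (A (sucMod i))) red-j
    where
      red-j : colour (B j) (ψ (A (sucMod i))) ≡ red
      red-j = trans (cong (λ z → colour z (ψ (A (sucMod i)))) (sym e))
                    (trans (ψ-preserves (B i) (A (sucMod i)) (λ ())) (colAB-successor i))

  A-rotates : ∀ i → ψ (A i) ≡ A (addMod i k₀)
  A-rotates = orbit-induction (λ i j → ψ (A i) ≡ A j) k₀ ψA₀ (A-follows ∘ B-follows)

  ψ-is-rotation : ∀ v → ψ v ≡ act k₀ v
  ψ-is-rotation (A i) = A-rotates i
  ψ-is-rotation (B i) = B-follows (A-rotates i)
  ψ-is-rotation (U t) = fixed-upto (toℕ t) t ℕP.≤-refl

↔-injective : ∀ {X Y : Set} (f : X ↔ Y) {x y} → Inverse.to f x ≡ Inverse.to f y → x ≡ y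
↔-injective f = Injection.injective (↔⇒↣ f)

module Transport {k N : ℕ} {X : Set} (φ : X ↔ Fin N)
                 (c : X → X → Fin k) (c-sym : ∀ x y → c x y ≡ c y x) where

  open Inverse φ using (to; from; strictlyInverseˡ; strictlyInverseʳ)

  induced : ColoredGraph k (Fin N)
  induced = record { col = λ x y _ → c (from x) (from y) ; symm = λ x y _ _ → c-sym (from x) (from y) }

  conj : Fin N ↔ Fin N → X → X
  conj π v = from (Inverse.to π (to v))

  conj-injective : ∀ π {x y} → conj π x ≡ conj π y → x ≡ y
  conj-injective π = ↔-injective φ ∘ ↔-injective π ∘ ↔-injective (↔-sym φ)

  aut⇒preserves : ∀ π → IsAut induced π → ∀ x y → x ≢ y → c (conj π x) (conj π y) ≡ c x y
  aut⇒preserves π aut x y x≢y =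
    trans (aut (to x) (to y) (x≢y ∘ ↔-injective φ) (x≢y ∘ ↔-injective φ ∘ ↔-injective π))
          (cong₂ c (strictlyInverseʳ x) (strictlyInverseʳ y))

  preserves⇒aut : ∀ π → (∀ x y → c (conj π x) (conj π y) ≡ c x y) → IsAut induced π
  preserves⇒aut π pres x y _ _ = trans (cong₂ c (conj-from x) (conj-from y)) (pres (from x) (from y))
    where
      conj-from : ∀ z → from (Inverse.to π z) ≡ conj π (from z)
      conj-from z = cong (λ w → from (Inverse.to π w)) (sym (strictlyInverseˡ z))

corollary3p4 : (n m : ℕ) → 3 ≤ n → Cn2⊕Im∈GR 3 n m
corollary3p4 (suc (suc (suc n₀))) m (s≤s (s≤s (s≤s z≤n))) =
  N , induced , φ , λ π → is-rotation π , is-automorphism π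
  where
    open Colouring n₀ m using (colour; colour-sym; act-preserves)
    N : ℕ
    N = (3 + n₀) * 2 + m
    φ : Dom (3 + n₀) m ↔ Fin N
    φ = ↔-sym (↔-trans +↔⊎ (*↔× ⊎-↔ ↔-refl))
    open Transport φ colour colour-sym

    is-rotation : ∀ π → IsAut induced π → InCn2⊕Im (conj π)
    is-rotation π aut = k₀ , ψ-is-rotation
      where open Rigidity n₀ m (conj π) (conj-injective π) (aut⇒preserves π aut)

    is-automorphism : ∀ π → InCn2⊕Im (conj π) → IsAut induced π
    is-automorphism π (k , conj≡act) = preserves⇒aut π λ x y →
      trans (cong₂ colour (conj≡act x) (conj≡act y)) (act-preserves k x y)
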